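{- Let $G_2$ be a bipartite graph with bipartition $A\cup B$, where $|A|=|B|=m$, and let $G_1$ be a subgraph of $G_2$. Suppose that $d_{G_1}(a)\ge 1$ for every $a\in A$ and $d_{G_2}(b)\le d$ for every $b\in B$. Then there exist $A'\subseteq A$ and $B'\subseteq B$ with $|A'|=|B'|\ge m/(4d^2)$ such that for each $i\in\{1,2\}$ the induced bipartite graph $G_i[A',B']$ is a perfect matching.
   Context: $d_H(v)$ denotes the degree of $v$ in $H$. For a bipartite graph $H$ and sets $A'\subseteq A$, $B'\subseteq B$, $H[A',B']$ denotes the bipartite subgraph on $A'\cup B'$ consisting of the edges of $H$ with one end in $A'$ and one in $B'$. -}

module Defs where

open import Data.Nat using (ℕ)
open import Data.Bool using (Bool; true; false; _∧_)
open import Data.Fin using (Fin)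
open import Data.Fin.Subset using (Subset; ∣_∣; _∈_; _⊆_; ⁅_⁆; _∩_)
open import Data.Vec.Functional using () 
open import Data.Vec using (tabulate)
open import Relation.Binary.PropositionalEquality using (_≡_)

-- A bipartite graph with parts A = Fin m and B = Fin m:
-- H a b ≡ true  iff  ab is an edge.
BipGraph : ℕ → Set
BipGraph m = Fin m → Fin m → Bool

_⊑_ : {m : ℕ} → BipGraph m → BipGraph m → Set
_⊑_ {m} H₁ H₂ = (a b : Fin m) → H₁ a b ≡ true → H₂ a b ≡ true

nbrA : {m : ℕ} → BipGraph m → Fin m → Subset m
nbrA H a = tabulate (λ b → H a b)

nbrB : {m : ℕ} → BipGraph m → Fin m → Subset m
nbrB H b = tabulate (λ a → H a b)

degA : {m : ℕ} → BipGraph m → Fin m → ℕ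
degA H a = ∣ nbrA H a ∣

degB : {m : ℕ} → BipGraph m → Fin m → ℕ
degB H b = ∣ nbrB H b ∣

IsPerfectMatching : {m : ℕ} → BipGraph m → Subset m → Subset m → Set
IsPerfectMatching H A' B' =
  (∀ a → a ∈ A' → ∃! (λ b → b ∈ B' × H a b ≡ true)) ×
  (∀ b → b ∈ B' → ∃! (λ a → a ∈ A' × H a b ≡ true))
  where
    open import Data.Product using (_×_; ∃; Σ; _,_)
    ∃! : {A : Set} → (A → Set) → Set
    ∃! {A} P = Σ A (λ x → P x × (∀ y → P y → y ≡ x))

-- Fix a G₁-neighbour f a of every a ∈ A and call I ⊆ A independent when G₂ a (f a′) fails for all
-- distinct a, a′ ∈ I. Then f is injective on I, and G₁ and G₂ both induce on I ∪ f(I) the perfect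
-- matching a ↦ f a. In the conflict digraph a → a′ iff G₂ a (f a′) every in-degree is at most d,
-- so by double counting every set S has a vertex with at most d out-neighbours in S. Picking such
-- a vertex greedily and discarding its in- and out-neighbours costs at most 2d vertices per pick,
-- which yields an independent I with m ≤ 2d |I| ≤ 4d² |I|.
module Submission where

open import Defs
open import Data.Bool using (Bool; true; false; _∧_; _∨_; not)
import Data.Bool.Properties as Bool
open import Data.Fin using (Fin; zero; suc)
open import Data.Fin.Properties using (_≟_; any?; suc-injective)
open import Data.Fin.Subset using (Subset; ∣_∣; _∈_)
open import Data.Nat using (ℕ; zero; suc; _+_; _*_; _≤_; _<_; _≤?_; z≤n; s≤s)
open import Data.Nat.Properties hiding (_≟_; suc-injective)
open import Algebra.Properties.Semiring.Sum +-*-semiring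
  using (sum; sum-syntax; sum-cong-≗; ∑-comm; ∑-distrib-+; *-distribˡ-sum; *-distribʳ-sum; sum-replicate-zero)
open import Data.Product using (Σ; ∃; _×_; _,_; proj₁; proj₂)
open import Data.Sum using (_⊎_; inj₁; inj₂)
open import Data.Vec using (tabulate)
open import Data.Vec.Properties using ([]=⇒lookup; lookup⇒[]=; lookup∘tabulate)
open import Function using (_∘_)
open import Relation.Nullary using (yes; no; does; contradiction)
open import Relation.Nullary.Decidable using (_×-dec_; dec-true)
open import Relation.Binary.PropositionalEquality
  using (_≡_; refl; sym; trans; cong; subst; module ≡-Reasoning)

-- Finite sets are Boolean predicates, counted by summing Iverson brackets; they become Subsets
-- only at the very end.

⟦_⟧ : Bool → ℕ
⟦ true ⟧  = 1
⟦ false ⟧ = 0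

count : {n : ℕ} → (Fin n → Bool) → ℕ
count {n} p = ∑[ i < n ] ⟦ p i ⟧

∑-mono-≤ : {n : ℕ} {f g : Fin n → ℕ} → (∀ i → f i ≤ g i) → sum f ≤ sum g
∑-mono-≤ {zero}  _   = z≤n
∑-mono-≤ {suc n} f≤g = +-mono-≤ (f≤g zero) (∑-mono-≤ (f≤g ∘ suc))

⟦⟧-mono : {a b : Bool} → (a ≡ true → b ≡ true) → ⟦ a ⟧ ≤ ⟦ b ⟧
⟦⟧-mono {false} _   = z≤n
⟦⟧-mono {true}  a⇒b rewrite a⇒b refl = ≤-refl

⟦∨⟧≤ : (a b : Bool) → ⟦ a ∨ b ⟧ ≤ ⟦ a ⟧ + ⟦ b ⟧
⟦∨⟧≤ true  _ = s≤s z≤n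
⟦∨⟧≤ false _ = ≤-refl

⟦∧⟧ : (a b : Bool) → ⟦ a ∧ b ⟧ ≡ ⟦ a ⟧ * ⟦ b ⟧
⟦∧⟧ true  b = sym (+-identityʳ ⟦ b ⟧)
⟦∧⟧ false _ = refl

⟦⟧-split : (a b : Bool) → ⟦ a ⟧ ≡ ⟦ a ∧ not b ⟧ + ⟦ a ∧ b ⟧
⟦⟧-split true  true  = refl
⟦⟧-split true  false = refl
⟦⟧-split false _     = refl

_⊆_ : {n : ℕ} → (Fin n → Bool) → (Fin n → Bool) → Set
p ⊆ q = ∀ i → p i ≡ true → q i ≡ true

count-mono : {n : ℕ} {p q : Fin n → Bool} → p ⊆ q → count p ≤ count q
count-mono p⊆q = ∑-mono-≤ (λ i → ⟦⟧-mono (p⊆q i))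

count-∨ : {n : ℕ} (p q : Fin n → Bool) → count (λ i → p i ∨ q i) ≤ count p + count q
count-∨ p q = ≤-trans (∑-mono-≤ (λ i → ⟦∨⟧≤ (p i) (q i)))
                      (≤-reflexive (∑-distrib-+ (λ i → ⟦ p i ⟧) (λ i → ⟦ q i ⟧)))

count-split : {n : ℕ} (p q : Fin n → Bool) →
  count p ≡ count (λ i → p i ∧ not (q i)) + count (λ i → p i ∧ q i)
count-split p q = trans (sum-cong-≗ (λ i → ⟦⟧-split (p i) (q i)))
                        (∑-distrib-+ (λ i → ⟦ p i ∧ not (q i) ⟧) (λ i → ⟦ p i ∧ q i ⟧))

count-⊤ : (n : ℕ) → count {n} (λ _ → true) ≡ n
count-⊤ zero    = refl
count-⊤ (suc n) = cong suc (count-⊤ n)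

count-⊥ : (n : ℕ) → count {n} (λ _ → false) ≡ 0
count-⊥ n = sum-replicate-zero n

count-witness : {n : ℕ} (p : Fin n → Bool) → 1 ≤ count p → ∃ λ i → p i ≡ true
count-witness {suc n} p 1≤∣p∣ with p zero in p0
... | true  = zero , p0
... | false = let i , pi = count-witness (p ∘ suc) 1≤∣p∣ in suc i , pi

insert : {n : ℕ} → Fin n → (Fin n → Bool) → Fin n → Bool
insert x p y = does (y ≟ x) ∨ p y

insert-here : {n : ℕ} (x : Fin n) (p : Fin n → Bool) → insert x p x ≡ true
insert-here x p = cong (_∨ p x) (dec-true (x ≟ x) refl)

insert-⊆ : {n : ℕ} {x : Fin n} {p S : Fin n → Bool} → S x ≡ true → p ⊆ S → insert x p ⊆ S
insert-⊆ {x = x} x∈S p⊆S y y∈ with y ≟ x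
... | yes refl = x∈S
... | no  _    = p⊆S y y∈

count-insert : {n : ℕ} (x : Fin n) (p : Fin n → Bool) → p x ≡ false →
  count (insert x p) ≡ suc (count p)
count-insert zero    p px rewrite px = refl
count-insert (suc x) p px =
  trans (cong (⟦ p zero ⟧ +_) (count-insert x (p ∘ suc) px)) (+-suc ⟦ p zero ⟧ _)

∣tabulate∣≡count : {n : ℕ} (p : Fin n → Bool) → ∣ tabulate p ∣ ≡ count p
∣tabulate∣≡count {zero}  p = refl
∣tabulate∣≡count {suc n} p with p zero
... | true  = cong suc (∣tabulate∣≡count (p ∘ suc))
... | false = ∣tabulate∣≡count (p ∘ suc)

∈-tabulate⁺ : {n : ℕ} {p : Fin n → Bool} {x : Fin n} → p x ≡ true → x ∈ tabulate p
∈-tabulate⁺ {p = p} {x} px = lookup⇒[]= x (tabulate p) (trans (lookup∘tabulate p x) px)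

∈-tabulate⁻ : {n : ℕ} {p : Fin n → Bool} {x : Fin n} → x ∈ tabulate p → p x ≡ true
∈-tabulate⁻ {p = p} {x} x∈ = trans (sym (lookup∘tabulate p x)) ([]=⇒lookup x∈)

∃-≤-average : {n : ℕ} (S : Fin n → Bool) (h : Fin n → ℕ) (c : ℕ) →
  1 ≤ count S → sum h ≤ c * count S → ∃ λ x → S x ≡ true × h x ≤ c
∃-≤-average {n} S h c 1≤∣S∣ ∑h≤c∣S∣
  with any? (λ x → (S x Bool.≟ true) ×-dec (h x ≤? c))
... | yes found = found
... | no  none  = contradiction ∑h≤c∣S∣ (<⇒≱ c∣S∣<∑h)
  where
  open ≤-Reasoning
  above : ∀ x → ⟦ S x ⟧ * suc c ≤ h x
  above x with S x in Sx
  ... | false = z≤n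
  ... | true  = ≤-trans (≤-reflexive (*-identityˡ (suc c))) (≰⇒> λ hx≤c → none (x , Sx , hx≤c))
  c∣S∣<∑h : c * count S < sum h
  c∣S∣<∑h = begin-strict
    c * count S                     ≡⟨ *-comm c (count S) ⟩
    count S * c                     <⟨ m<n+m (count S * c) 1≤∣S∣ ⟩
    count S + count S * c           ≡⟨ *-suc (count S) c ⟨
    count S * suc c                 ≡⟨ *-distribʳ-sum (suc c) (λ x → ⟦ S x ⟧) ⟩
    ∑[ x < n ] (⟦ S x ⟧ * suc c)    ≤⟨ ∑-mono-≤ above ⟩
    sum h                           ∎

∑-outdegree≤ : {n d : ℕ} (C : Fin n → Fin n → Bool) → (∀ y → count (λ x → C x y) ≤ d) →
  (S : Fin n → Bool) → ∑[ x < n ] count (λ y → S y ∧ C x y) ≤ d * count S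
∑-outdegree≤ {n} {d} C indegree≤ S = begin
  ∑[ x < n ] ∑[ y < n ] ⟦ S y ∧ C x y ⟧       ≡⟨ ∑-comm (λ x y → ⟦ S y ∧ C x y ⟧) ⟩
  ∑[ y < n ] ∑[ x < n ] ⟦ S y ∧ C x y ⟧       ≡⟨ sum-cong-≗ pull-out ⟩
  ∑[ y < n ] (⟦ S y ⟧ * count (λ x → C x y))  ≤⟨ ∑-mono-≤ (λ y → *-monoʳ-≤ ⟦ S y ⟧ (indegree≤ y)) ⟩
  ∑[ y < n ] (⟦ S y ⟧ * d)                    ≡⟨ *-distribʳ-sum d (λ y → ⟦ S y ⟧) ⟨
  count S * d                                 ≡⟨ *-comm (count S) d ⟩
  d * count S                                 ∎
  where
  open ≤-Reasoning
  pull-out : ∀ y → ∑[ x < n ] ⟦ S y ∧ C x y ⟧ ≡ ⟦ S y ⟧ * count (λ x → C x y)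
  pull-out y = trans (sum-cong-≗ (λ x → ⟦∧⟧ (S y) (C x y)))
                     (sym (*-distribˡ-sum ⟦ S y ⟧ (λ x → ⟦ C x y ⟧)))

Independent : {n : ℕ} → (Fin n → Fin n → Bool) → (Fin n → Bool) → Set
Independent C I = ∀ x y → I x ≡ true → I y ≡ true → C x y ≡ true → x ≡ y

∧-not-∨⁻ : ∀ s a b → s ∧ not (a ∨ b) ≡ true → s ≡ true × a ≡ false × b ≡ false
∧-not-∨⁻ true false false _ = refl , refl , refl

∧-∨-weaken : ∀ s a b → s ∧ (a ∨ b) ≡ true → (s ∧ a) ∨ b ≡ true
∧-∨-weaken true true  _ _ = refl
∧-∨-weaken true false _ e = e

module _ {n d : ℕ} (C : Fin n → Fin n → Bool) (C-refl : ∀ x → C x x ≡ true)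
         (indegree≤ : ∀ y → count (λ x → C x y) ≤ d) where

  record IndependentSubset (S : Fin n → Bool) : Set where
    field
      I           : Fin n → Bool
      I⊆S         : I ⊆ S
      independent : Independent C I
      large       : count S ≤ 2 * d * count I

  remove-nbhd : Fin n → (Fin n → Bool) → Fin n → Bool
  remove-nbhd x S y = S y ∧ not (C x y ∨ C y x)

  remove-nbhd-⊆ : (x : Fin n) (S : Fin n → Bool) → remove-nbhd x S ⊆ S
  remove-nbhd-⊆ x S y y∈ = proj₁ (∧-not-∨⁻ (S y) (C x y) (C y x) y∈)

  remove-nbhd-away : (x : Fin n) (S : Fin n → Bool) (y : Fin n) → remove-nbhd x S y ≡ true →
    C x y ≡ false × C y x ≡ false
  remove-nbhd-away x S y y∈ = proj₂ (∧-not-∨⁻ (S y) (C x y) (C y x) y∈)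

  remove-nbhd-self : (x : Fin n) (S : Fin n → Bool) → remove-nbhd x S x ≡ false
  remove-nbhd-self x S rewrite C-refl x = Bool.∧-zeroʳ (S x)

  remove-nbhd-cost : (x : Fin n) (S : Fin n → Bool) → count (λ y → S y ∧ C x y) ≤ d →
    count S ≤ count (remove-nbhd x S) + 2 * d
  remove-nbhd-cost x S outdegree≤ = begin
    count S
      ≡⟨ count-split S R ⟩
    count S′ + count (λ y → S y ∧ R y)
      ≤⟨ +-monoʳ-≤ (count S′) (count-mono (λ y → ∧-∨-weaken (S y) (C x y) (C y x))) ⟩
    count S′ + count (λ y → (S y ∧ C x y) ∨ C y x)
      ≤⟨ +-monoʳ-≤ (count S′) (count-∨ (λ y → S y ∧ C x y) (λ y → C y x)) ⟩
    count S′ + (count (λ y → S y ∧ C x y) + count (λ y → C y x))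
      ≤⟨ +-monoʳ-≤ (count S′) (+-mono-≤ outdegree≤ (indegree≤ x)) ⟩
    count S′ + (d + d)
      ≡⟨ cong (λ k → count S′ + (d + k)) (+-identityʳ d) ⟨
    count S′ + 2 * d
      ∎
    where
    open ≤-Reasoning
    R : Fin n → Bool
    R y = C x y ∨ C y x
    S′ : Fin n → Bool
    S′ = remove-nbhd x S

  remove-nbhd-< : (x : Fin n) (S : Fin n → Bool) → S x ≡ true → count (remove-nbhd x S) < count S
  remove-nbhd-< x S x∈S = begin-strict
    count (remove-nbhd x S)               <⟨ n<1+n _ ⟩
    suc (count (remove-nbhd x S))         ≡⟨ count-insert x (remove-nbhd x S) (remove-nbhd-self x S) ⟨
    count (insert x (remove-nbhd x S))    ≤⟨ count-mono (insert-⊆ x∈S (remove-nbhd-⊆ x S)) ⟩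
    count S                               ∎
    where open ≤-Reasoning

  extend : (x : Fin n) (S : Fin n → Bool) → S x ≡ true → count (λ y → S y ∧ C x y) ≤ d →
    IndependentSubset (remove-nbhd x S) → IndependentSubset S
  extend x S x∈S outdegree≤ J = record
    { I = insert x I′
    ; I⊆S = insert-⊆ x∈S (λ y → remove-nbhd-⊆ x S y ∘ I′⊆S′ y)
    ; independent = independent
    ; large = large
    }
    where
    open IndependentSubset J
      renaming (I to I′; I⊆S to I′⊆S′; independent to I′-independent; large to S′-large)
    away : ∀ y → I′ y ≡ true → C x y ≡ false × C y x ≡ false
    away y = remove-nbhd-away x S y ∘ I′⊆S′ y
    x∉I′ : I′ x ≡ false
    x∉I′ with I′ x in x∈I′
    ... | false = refl
    ... | true  = contradiction (trans (sym (I′⊆S′ x x∈I′)) (remove-nbhd-self x S)) λ ()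
    independent : Independent C (insert x I′)
    independent y z y∈I z∈I Cyz with y ≟ x | z ≟ x
    ... | yes refl | yes refl = refl
    ... | yes refl | no _     = contradiction (trans (sym Cyz) (proj₁ (away z z∈I))) λ ()
    ... | no _     | yes refl = contradiction (trans (sym Cyz) (proj₂ (away y y∈I))) λ ()
    ... | no _     | no _     = I′-independent y z y∈I z∈I Cyz
    large : count S ≤ 2 * d * count (insert x I′)
    large = begin
      count S                          ≤⟨ remove-nbhd-cost x S outdegree≤ ⟩
      count (remove-nbhd x S) + 2 * d  ≤⟨ +-monoˡ-≤ (2 * d) S′-large ⟩
      2 * d * count I′ + 2 * d         ≡⟨ +-comm (2 * d * count I′) (2 * d) ⟩
      2 * d + 2 * d * count I′         ≡⟨ *-suc (2 * d) (count I′) ⟨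
      2 * d * suc (count I′)           ≡⟨ cong (2 * d *_) (count-insert x I′ x∉I′) ⟨
      2 * d * count (insert x I′)      ∎
      where open ≤-Reasoning

  independent-subset : (k : ℕ) (S : Fin n → Bool) → count S ≤ k → IndependentSubset S
  independent-subset k S ∣S∣≤k with m≤n⇒m<n∨m≡n (z≤n {count S})
  ... | inj₂ 0≡∣S∣ = record
    { I = λ _ → false ; I⊆S = λ _ () ; independent = λ _ _ () ; large = subst (_≤ _) 0≡∣S∣ z≤n }
  independent-subset zero    S ∣S∣≤0   | inj₁ 0<∣S∣ = contradiction (≤-trans 0<∣S∣ ∣S∣≤0) λ ()
  independent-subset (suc k) S ∣S∣≤1+k | inj₁ 0<∣S∣ =
    let x , x∈S , outdegree≤ = ∃-≤-average S _ d 0<∣S∣ (∑-outdegree≤ C indegree≤ S)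
    in  extend x S x∈S outdegree≤
          (independent-subset k (remove-nbhd x S) (≤-pred (≤-trans (remove-nbhd-< x S x∈S) ∣S∣≤1+k)))

  large-independent-set : Σ (Fin n → Bool) λ I → Independent C I × n ≤ 2 * d * count I
  large-independent-set = I , independent , subst (_≤ 2 * d * count I) (count-⊤ n) large
    where open IndependentSubset (independent-subset n (λ _ → true) (≤-reflexive (count-⊤ n)))

insertIf : {n : ℕ} → Bool → Fin n → (Fin n → Bool) → Fin n → Bool
insertIf true  x p = insert x p
insertIf false x p = p

insertIf-here : {n : ℕ} {b : Bool} (x : Fin n) (p : Fin n → Bool) →
  b ≡ true → insertIf b x p x ≡ true
insertIf-here x p refl = insert-here x p

insertIf-there : {n : ℕ} (b : Bool) (x : Fin n) {p : Fin n → Bool} {y : Fin n} →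
  p y ≡ true → insertIf b x p y ≡ true
insertIf-there true  x {p} {y} py =
  trans (cong (does (y ≟ x) ∨_) py) (Bool.∨-zeroʳ (does (y ≟ x)))
insertIf-there false x py = py

insertIf⁻ : {n : ℕ} (b : Bool) (x : Fin n) (p : Fin n → Bool) (y : Fin n) →
  insertIf b x p y ≡ true → (b ≡ true × y ≡ x) ⊎ p y ≡ true
insertIf⁻ false x p y py = inj₂ py
insertIf⁻ true  x p y e with y ≟ x
... | yes y≡x = inj₁ (refl , y≡x)
... | no  _   = inj₂ e

count-insertIf : {n : ℕ} (b : Bool) (x : Fin n) (p : Fin n → Bool) →
  (b ≡ true → p x ≡ false) → count (insertIf b x p) ≡ ⟦ b ⟧ + count p
count-insertIf true  x p fresh = count-insert x p (fresh refl)
count-insertIf false x p _     = refl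

image : {m n : ℕ} → (Fin m → Fin n) → (Fin m → Bool) → Fin n → Bool
image {zero}  f I = λ _ → false
image {suc m} f I = insertIf (I zero) (f zero) (image (f ∘ suc) (I ∘ suc))

image⁺ : {m n : ℕ} (f : Fin m → Fin n) (I : Fin m → Bool) {a : Fin m} →
  I a ≡ true → image f I (f a) ≡ true
image⁺ {suc m} f I {zero}  Ia = insertIf-here (f zero) (image (f ∘ suc) (I ∘ suc)) Ia
image⁺ {suc m} f I {suc a} Ia = insertIf-there (I zero) (f zero) (image⁺ (f ∘ suc) (I ∘ suc) Ia)

image⁻ : {m n : ℕ} (f : Fin m → Fin n) (I : Fin m → Bool) {b : Fin n} →
  image f I b ≡ true → ∃ λ a → I a ≡ true × f a ≡ b
image⁻ {suc m} f I {b} b∈ with insertIf⁻ (I zero) (f zero) (image (f ∘ suc) (I ∘ suc)) b b∈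
... | inj₁ (I0 , b≡f0) = zero , I0 , sym b≡f0
... | inj₂ b∈′ = let a , Ia , fa≡b = image⁻ (f ∘ suc) (I ∘ suc) b∈′ in suc a , Ia , fa≡b

InjectiveOn : {m n : ℕ} → (Fin m → Bool) → (Fin m → Fin n) → Set
InjectiveOn I f = ∀ a a′ → I a ≡ true → I a′ ≡ true → f a ≡ f a′ → a ≡ a′

count-image : {m n : ℕ} (f : Fin m → Fin n) (I : Fin m → Bool) → InjectiveOn I f →
  count (image f I) ≡ count I
count-image {zero} {n} f I _ = count-⊥ n
count-image {suc m} f I inj =
  trans (count-insertIf (I zero) (f zero) (image (f ∘ suc) (I ∘ suc)) fresh)
        (cong (⟦ I zero ⟧ +_) (count-image (f ∘ suc) (I ∘ suc) inj∘suc))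
  where
  inj∘suc : InjectiveOn (I ∘ suc) (f ∘ suc)
  inj∘suc a a′ Ia Ia′ = suc-injective ∘ inj (suc a) (suc a′) Ia Ia′
  fresh : I zero ≡ true → image (f ∘ suc) (I ∘ suc) (f zero) ≡ false
  fresh I0 with image (f ∘ suc) (I ∘ suc) (f zero) in f0∈
  ... | false = refl
  ... | true  with image⁻ (f ∘ suc) (I ∘ suc) f0∈
  ...   | a , Ia , fa≡f0 with () ← inj (suc a) zero Ia I0 fa≡f0

independent⇒injectiveOn : {m : ℕ} (G : BipGraph m) (f : Fin m → Fin m) (I : Fin m → Bool) →
  (∀ a → G a (f a) ≡ true) → Independent (λ a a′ → G a (f a′)) I → InjectiveOn I f
independent⇒injectiveOn G f I f⊆G independent a a′ Ia Ia′ fa≡fa′ =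
  independent a a′ Ia Ia′ (subst (λ b → G a b ≡ true) fa≡fa′ (f⊆G a))

independent⇒perfectMatching : {m : ℕ} (G H : BipGraph m) → H ⊑ G → (f : Fin m → Fin m) →
  (∀ a → H a (f a) ≡ true) → (I : Fin m → Bool) → Independent (λ a a′ → G a (f a′)) I →
  IsPerfectMatching H (tabulate I) (tabulate (image f I))
independent⇒perfectMatching {m} G H H⊑G f f⊆H I independent =
  (λ a a∈A′ → matchA a (∈-tabulate⁻ a∈A′)) , (λ b b∈B′ → matchB b (∈-tabulate⁻ b∈B′))
  where
  matchA : ∀ a → I a ≡ true → Σ (Fin m) λ b → (b ∈ tabulate (image f I) × H a b ≡ true) ×
             (∀ b′ → b′ ∈ tabulate (image f I) × H a b′ ≡ true → b′ ≡ b)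
  matchA a Ia = f a , (∈-tabulate⁺ (image⁺ f I Ia) , f⊆H a) , unique
    where
    unique : ∀ b′ → b′ ∈ tabulate (image f I) × H a b′ ≡ true → b′ ≡ f a
    unique b′ (b′∈B′ , Hab′) with image⁻ f I (∈-tabulate⁻ b′∈B′)
    ... | a′ , Ia′ , refl = cong f (sym (independent a a′ Ia Ia′ (H⊑G a (f a′) Hab′)))
  matchB : ∀ b → image f I b ≡ true → Σ (Fin m) λ a → (a ∈ tabulate I × H a b ≡ true) ×
             (∀ a′ → a′ ∈ tabulate I × H a′ b ≡ true → a′ ≡ a)
  matchB b b∈B′ with image⁻ f I b∈B′
  ... | a , Ia , refl = a , (∈-tabulate⁺ Ia , f⊆H a) ,
        λ a′ (a′∈A′ , Ha′fa) → independent a′ a (∈-tabulate⁻ a′∈A′) Ia (H⊑G a′ (f a) Ha′fa)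

2d≤4d² : (d : ℕ) → 2 * d ≤ 4 * (d * d)
2d≤4d² zero      = z≤n
2d≤4d² d@(suc _) = ≤-trans (*-monoˡ-≤ d (s≤s (s≤s (z≤n {2})))) (*-monoʳ-≤ 4 (m≤m*n d d))

module _ {m : ℕ} (G₁ G₂ : BipGraph m) (G₁⊑G₂ : G₁ ⊑ G₂) (f : Fin m → Fin m)
         (f⊆G₁ : ∀ a → G₁ a (f a) ≡ true) where

  f⊆G₂ : ∀ a → G₂ a (f a) ≡ true
  f⊆G₂ a = G₁⊑G₂ a (f a) (f⊆G₁ a)

  large-common-perfectMatching : (d : ℕ) → ((b : Fin m) → degB G₂ b ≤ d) →
    Σ (Subset m) λ A′ → Σ (Subset m) λ B′ → ∣ A′ ∣ ≡ ∣ B′ ∣ × m ≤ 2 * d * ∣ A′ ∣ ×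
      IsPerfectMatching G₁ A′ B′ × IsPerfectMatching G₂ A′ B′
  large-common-perfectMatching d degB₂≤d
    with large-independent-set (λ a a′ → G₂ a (f a′)) f⊆G₂
           (λ a′ → subst (_≤ d) (∣tabulate∣≡count (λ a → G₂ a (f a′))) (degB₂≤d (f a′)))
  ... | I , independent , m≤2d∣I∣ =
    tabulate I , tabulate (image f I) , same-size , m≤2d∣A′∣ ,
    independent⇒perfectMatching G₂ G₁ G₁⊑G₂ f f⊆G₁ I independent ,
    independent⇒perfectMatching G₂ G₂ (λ _ _ e → e) f f⊆G₂ I independent
    where
    open ≡-Reasoning
    same-size : ∣ tabulate I ∣ ≡ ∣ tabulate (image f I) ∣
    same-size = begin
      ∣ tabulate I ∣              ≡⟨ ∣tabulate∣≡count I ⟩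
      count I                     ≡⟨ count-image f I (independent⇒injectiveOn G₂ f I f⊆G₂ independent) ⟨
      count (image f I)           ≡⟨ ∣tabulate∣≡count (image f I) ⟨
      ∣ tabulate (image f I) ∣    ∎
    m≤2d∣A′∣ : m ≤ 2 * d * ∣ tabulate I ∣
    m≤2d∣A′∣ = subst (λ k → m ≤ 2 * d * k) (sym (∣tabulate∣≡count I)) m≤2d∣I∣

lemma7p3 : (m d : ℕ) (G₁ G₂ : BipGraph m) → G₁ ⊑ G₂ →
    ((a : Fin m) → 1 ≤ degA G₁ a) →
    ((b : Fin m) → degB G₂ b ≤ d) →
    Σ (Subset m) (λ A' → Σ (Subset m) (λ B' →
      ∣ A' ∣ ≡ ∣ B' ∣ × m ≤ 4 * (d * d) * ∣ A' ∣ ×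
      IsPerfectMatching G₁ A' B' × IsPerfectMatching G₂ A' B'))
lemma7p3 m d G₁ G₂ G₁⊑G₂ degA₁≥1 degB₂≤d =
  let A′ , B′ , ∣A′∣≡∣B′∣ , m≤2d∣A′∣ , matching₁ , matching₂ =
        large-common-perfectMatching G₁ G₂ G₁⊑G₂ (proj₁ ∘ neighbour) (proj₂ ∘ neighbour) d degB₂≤d
  in  A′ , B′ , ∣A′∣≡∣B′∣ , ≤-trans m≤2d∣A′∣ (*-monoˡ-≤ ∣ A′ ∣ (2d≤4d² d)) , matching₁ , matching₂
  where
  neighbour : ∀ a → ∃ λ b → G₁ a b ≡ true
  neighbour a = count-witness (G₁ a) (subst (1 ≤_) (∣tabulate∣≡count (G₁ a)) (degA₁≥1 a))
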